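{- For all $\pi_1,\pi_2\in\mathrm{DWD}_m$ with $\pi_1\le\pi_2$ in the Bruhat order, we have $\varphi(\pi_1)\le\varphi(\pi_2)$ in $S_2^{\mathcal{C}_m}$.
   Context: Let $[n]=\{0,\dots,n-1\}$, $S_n$ the bijections of $[n]$, $m\ge1$. A basic $k$-interval ($0\le k\le m$) is $\{c2^k,\dots,(c+1)2^k-1\}\subseteq[2^m]$. $\pi\in S_{2^m}$ is dyadically well-distributed if for every basic $k_1$-interval $S$ and basic $k_2$-interval $T$ with $k_1+k_2=m$ there is exactly one $i\in S$ with $\pi(i)\in T$; $\mathrm{DWD}_m$ is the set of these. Length = number of inversions; Bruhat order: $\pi_1\le\pi_2$ iff $\pi_2=\pi_1t_1\cdots t_k$ for transpositions with lengths of successive partial products strictly increasing. A complementary pair is $(S,T)$ with $S$ a basic $k_1$-interval, $T$ a basic $k_2$-interval, $k_1+k_2=m+1$, $k_1,k_2\ge1$; $\mathcal{C}_m$ is the set of these. For $\pi\in\mathrm{DWD}_m$ and $(S,T)\in\mathcal{C}_m$ there are exactly two $a<b$ in $S$ with $\pi(a),\pi(b)\in T$; $\varphi(\pi)(S,T)=e$ if $\pi(a)<\pi(b)$ and $s$ otherwise. $S_2^{\mathcal{C}_m}$ is the set of functions $\mathcal{C}_m\to\{e,s\}$, ordered componentwise with $e<s$. -}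

module Defs where

open import Data.Nat using (ℕ; zero; suc; _+_; _*_; _∸_; _^_; _≤_; _<_; _≤ᵇ_; _<ᵇ_)
open import Data.Fin using (Fin; toℕ; _≟_)
open import Data.Fin.Permutation using (Permutation′; _⟨$⟩ʳ_)
open import Data.Bool using (Bool; true; false; _∧_; if_then_else_)
open import Data.List using (List; []; _∷_; allFin; filterᵇ; length; concatMap)
open import Data.Product using (Σ; _×_; _,_)
open import Relation.Binary.PropositionalEquality using (_≡_; _≢_)
open import Relation.Nullary using (does)

isInv : ∀ {n} → (Fin n → Fin n) → Fin n → Fin n → Bool
isInv f a b = (toℕ a <ᵇ toℕ b) ∧ (toℕ (f b) <ᵇ toℕ (f a))

inversions : ∀ {n} → (Fin n → Fin n) → ℕ
inversions {n} f =
  length (concatMap (λ a → filterᵇ (isInv f a) (allFin n)) (allFin n))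

swap : ∀ {n} → Fin n → Fin n → Fin n → Fin n
swap i j x = if does (x ≟ i) then j else (if does (x ≟ j) then i else x)

_∘f_ : ∀ {n} → (Fin n → Fin n) → (Fin n → Fin n) → Fin n → Fin n
(f ∘f g) x = f (g x)

data BruhatChain {n : ℕ} : (Fin n → Fin n) → (Fin n → Fin n) → Set where
  done : ∀ {f g} → (∀ x → f x ≡ g x) → BruhatChain f g
  step : ∀ {f g} (i j : Fin n) → i ≢ j →
         inversions f < inversions (f ∘f swap i j) →
         BruhatChain (f ∘f swap i j) g → BruhatChain f g

_≤B_ : ∀ {n} → Permutation′ n → Permutation′ n → Set
π₁ ≤B π₂ = BruhatChain (π₁ ⟨$⟩ʳ_) (π₂ ⟨$⟩ʳ_)

-- Basic k-interval of [2^m] with index c: {c 2^k, …, (c+1) 2^k - 1},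
-- required to lie inside [2^m].
record BasicInterval (m : ℕ) : Set where
  constructor interval
  field
    lev   : ℕ
    idx   : ℕ
    lev≤m : lev ≤ m
    fits  : suc idx * 2 ^ lev ≤ 2 ^ m
open BasicInterval public

_∈I_ : ∀ {m} → Fin (2 ^ m) → BasicInterval m → Set
x ∈I I = (idx I * 2 ^ lev I ≤ toℕ x) × (toℕ x < suc (idx I) * 2 ^ lev I)

_∈Iᵇ_ : ∀ {m} → Fin (2 ^ m) → BasicInterval m → Bool
x ∈Iᵇ I = (idx I * 2 ^ lev I ≤ᵇ toℕ x) ∧ (toℕ x <ᵇ suc (idx I) * 2 ^ lev I)

DWD : (m : ℕ) → Permutation′ (2 ^ m) → Set
DWD m π = (S T : BasicInterval m) → lev S + lev T ≡ m →
  Σ (Fin (2 ^ m)) λ i → ((i ∈I S) × ((π ⟨$⟩ʳ i) ∈I T)) ×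
    ((j : Fin (2 ^ m)) → (j ∈I S) × ((π ⟨$⟩ʳ j) ∈I T) → j ≡ i)

record ComplementaryPair (m : ℕ) : Set where
  constructor cpair
  field
    S   : BasicInterval m
    T   : BasicInterval m
    sum : lev S + lev T ≡ suc m
    S≥1 : 1 ≤ lev S
    T≥1 : 1 ≤ lev T

data S₂ : Set where
  e s : S₂

data _≤₂_ : S₂ → S₂ → Set where
  e≤e : e ≤₂ e
  e≤s : e ≤₂ s
  s≤s : s ≤₂ s

-- φ(π)(S,T): list the a ∈ S (in increasing order) with π(a) ∈ T; for
-- π ∈ DWD_m this list is exactly [a, b] with a < b, and the value is e if
-- π(a) < π(b), s otherwise.  (Other list shapes never occur for DWD π;
-- they are given the junk value e.)
φ-list : ∀ {m} → Permutation′ (2 ^ m) → List (Fin (2 ^ m)) → S₂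
φ-list {m} π (a ∷ b ∷ []) = if toℕ (π ⟨$⟩ʳ a) <ᵇ toℕ (π ⟨$⟩ʳ b) then e else s
φ-list π _ = e

φ : ∀ {m} → Permutation′ (2 ^ m) → ComplementaryPair m → S₂
φ {m} π P = φ-list {m} π (filterᵇ (λ a → (_∈Iᵇ_ {m} a S) ∧ (_∈Iᵇ_ {m} (π ⟨$⟩ʳ a) T)) (allFin (2 ^ m)))
  where open ComplementaryPair P

_≤φ_ : ∀ {m} → (ComplementaryPair m → S₂) → (ComplementaryPair m → S₂) → Set
_≤φ_ {m} F G = (P : ComplementaryPair m) → F P ≤₂ G P

-- For a permutation f let rank f p q count the a < p with f a < q.  One direction of the
-- classical rank criterion for the Bruhat order says that going up in Bruhat order can only
-- decrease every rank.  Now let (S, T) be a complementary pair with lower and upper halves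
-- S₀, S₁ and T₀, T₁, and evaluate the rank at the centre (min S₁, min T₁) of S × T.  The
-- region it counts is tiled by products of basic intervals whose levels add up to m, each
-- holding exactly one point of a well-distributed π, plus the quadrant S₀ × T₀.  The two
-- points a < b of π in S × T have a ∈ S₀, b ∈ S₁, and exactly one of π a, π b lies in T₀;
-- so S₀ × T₀ contains a point iff π a < π b, i.e. iff φ(π)(S, T) = e.  Hence the rank at
-- the centre is a constant plus [φ(π)(S, T) = e], and the theorem follows.
module Submission where

open import Defs
open import Algebra.Bundles using (CommutativeMonoid)
open import Data.Bool using (Bool; true; false; _∧_; not; if_then_else_; T; T?)
open import Data.Bool.Properties using (T-≡; T-∧; ∧-zeroʳ; ∧-identityʳ; ∧-assoc; ∧-comm; ∧-commutativeMonoid)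
open import Algebra.Properties.CommutativeSemigroup
  (CommutativeMonoid.commutativeSemigroup ∧-commutativeMonoid) using (interchange; xy∙z≈xz∙y)
open import Data.Empty using (⊥; ⊥-elim)
open import Data.Fin as Fin using (Fin; zero; suc; toℕ; _≟_)
open import Data.Fin.Properties using (toℕ-injective; <⇒≢)
open import Data.Fin.Permutation using (Permutation′; _⟨$⟩ʳ_)
open import Data.List using (List; []; _∷_; length; filterᵇ; tabulate; allFin; concatMap)
open import Data.List.Properties using (length-++)
open import Data.List.Relation.Unary.AllPairs using (AllPairs; _∷_)
import Data.List.Relation.Unary.AllPairs.Properties as AllPairs
open import Data.List.Relation.Unary.All using ([]; _∷_)
open import Data.Nat using (ℕ; zero; suc; _+_; _*_; _^_; _≤_; _<_; _≤ᵇ_; _<ᵇ_; z≤n; s≤s)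
open import Data.Nat.Properties hiding (_≟_; <⇒≢)
open import Data.Product using (_×_; _,_)
open import Function using (_∘_; Equivalence)
open import Relation.Binary using (tri<; tri≈; tri>)
open import Relation.Binary.PropositionalEquality
open import Relation.Nullary using (does; yes; no)
open import Relation.Nullary.Reflects using (ofʸ; ofⁿ)
open import Algebra.Properties.Semiring.Sum +-*-semiring

𝟙 : Bool → ℕ
𝟙 true  = 1
𝟙 false = 0

-- Rearrangement inequality for 0/1 values: (q - p)(t - r) ≥ 0.
𝟙-rearrangement : ∀ {p q r t} → (T p → T q) → (T r → T t) →
                  𝟙 (p ∧ t) + 𝟙 (q ∧ r) ≤ 𝟙 (p ∧ r) + 𝟙 (q ∧ t)
𝟙-rearrangement {true}  {true}  {r}     {t}     _   _   = ≤-reflexive (+-comm (𝟙 t) (𝟙 r))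
𝟙-rearrangement {true}  {false} {_}     {_}     p⇒q _   = ⊥-elim (p⇒q _)
𝟙-rearrangement {false} {false} {_}     {_}     _   _   = ≤-refl
𝟙-rearrangement {false} {true}  {false} {_}     _   _   = z≤n
𝟙-rearrangement {false} {true}  {true}  {true}  _   _   = ≤-refl
𝟙-rearrangement {false} {true}  {true}  {false} _   r⇒t = ⊥-elim (r⇒t _)

𝟙-rearrangement′ : ∀ {p q r t} → (T p → T q) → (T r → T t) →
                   𝟙 (q ∧ r) + 𝟙 (p ∧ t) ≤ 𝟙 (q ∧ t) + 𝟙 (p ∧ r)
𝟙-rearrangement′ {p} {q} {r} {t} p⇒q r⇒t =
  subst₂ _≤_ (+-comm (𝟙 (p ∧ t)) (𝟙 (q ∧ r))) (+-comm (𝟙 (p ∧ r)) (𝟙 (q ∧ t)))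
             (𝟙-rearrangement p⇒q r⇒t)

<ᵇ-true : ∀ {x y} → x < y → (x <ᵇ y) ≡ true
<ᵇ-true x<y = Equivalence.to T-≡ (<⇒<ᵇ x<y)

<ᵇ-false : ∀ {x y} → y ≤ x → (x <ᵇ y) ≡ false
<ᵇ-false {x} {y} y≤x with x <ᵇ y | <ᵇ-reflects-< x y
... | false | _       = refl
... | true  | ofʸ x<y = ⊥-elim (<⇒≱ x<y y≤x)

≤ᵇ-true : ∀ {x y} → x ≤ y → (x ≤ᵇ y) ≡ true
≤ᵇ-true x≤y = Equivalence.to T-≡ (≤⇒≤ᵇ x≤y)

≤ᵇ-false : ∀ {x y} → y < x → (x ≤ᵇ y) ≡ false
≤ᵇ-false {x} {y} y<x with x ≤ᵇ y | ≤ᵇ-reflects-≤ x y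
... | false | _       = refl
... | true  | ofʸ x≤y = ⊥-elim (<⇒≱ y<x x≤y)

<ᵇ-≤-trans : ∀ {x y z} → T (x <ᵇ y) → y ≤ z → T (x <ᵇ z)
<ᵇ-≤-trans {x} {y} x<y y≤z = <⇒<ᵇ (<-≤-trans (<ᵇ⇒< x y x<y) y≤z)

≤-<ᵇ-trans : ∀ {x y z} → x ≤ y → T (y <ᵇ z) → T (x <ᵇ z)
≤-<ᵇ-trans {_} {y} {z} x≤y y<z = <⇒<ᵇ (≤-<-trans x≤y (<ᵇ⇒< y z y<z))

straddle : ∀ {a b t} → 𝟙 (a <ᵇ t) + 𝟙 (b <ᵇ t) ≡ 1 → (a <ᵇ b) ≡ (a <ᵇ t)
straddle {a} {b} {t} one with a <ᵇ t | <ᵇ-reflects-< a t | b <ᵇ t | <ᵇ-reflects-< b t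
... | true  | ofʸ a<t | false | ofⁿ b≮t = <ᵇ-true (<-≤-trans a<t (≮⇒≥ b≮t))
... | false | ofⁿ a≮t | true  | ofʸ b<t = <ᵇ-false (<⇒≤ (<-≤-trans b<t (≮⇒≥ a≮t)))
... | true  | _       | true  | _       = ⊥-elim (1+n≢0 (suc-injective one))
... | false | _       | false | _       = ⊥-elim (0≢1+n one)

inRange : ℕ → ℕ → ℕ → Bool
inRange l r x = (l ≤ᵇ x) ∧ (x <ᵇ r)

inRange⁺ : ∀ {l r x} → (l ≤ x) × (x < r) → T (inRange l r x)
inRange⁺ (l≤x , x<r) = Equivalence.from T-∧ (≤⇒≤ᵇ l≤x , <⇒<ᵇ x<r)

inRange⁻ : ∀ {l r x} → T (inRange l r x) → (l ≤ x) × (x < r)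
inRange⁻ {l} {r} {x} t with Equivalence.to T-∧ t
... | l≤x , x<r = ≤ᵇ⇒≤ l x l≤x , <ᵇ⇒< x r x<r

inRange-split : ∀ {l m r} → l ≤ m → m ≤ r → ∀ x →
                𝟙 (inRange l r x) ≡ 𝟙 (inRange l m x) + 𝟙 (inRange m r x)
inRange-split {l} {m} {r} l≤m m≤r x with x <ᵇ m | <ᵇ-reflects-< x m
... | true  | ofʸ x<m
  rewrite <ᵇ-true (<-≤-trans x<m m≤r) | ≤ᵇ-false {m} {x} x<m = sym (+-identityʳ _)
... | false | ofⁿ x≮m
  rewrite ≤ᵇ-true (≤-trans l≤m (≮⇒≥ x≮m)) | ≤ᵇ-true {m} {x} (≮⇒≥ x≮m) = refl

inRange-∧-<ᵇ : ∀ l {m r} → m ≤ r → ∀ x → inRange l r x ∧ (x <ᵇ m) ≡ inRange l m x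
inRange-∧-<ᵇ l {m} {r} m≤r x with x <ᵇ m | <ᵇ-reflects-< x m
... | true  | ofʸ x<m rewrite <ᵇ-true (<-≤-trans x<m m≤r) = ∧-identityʳ _
... | false | _       = trans (∧-zeroʳ (inRange l r x)) (sym (∧-zeroʳ (l ≤ᵇ x)))

sum-mono-≤ : ∀ {n} {h k : Fin n → ℕ} → (∀ a → h a ≤ k a) → sum h ≤ sum k
sum-mono-≤ {zero}  _   = z≤n
sum-mono-≤ {suc n} h≤k = +-mono-≤ (h≤k zero) (sum-mono-≤ (h≤k ∘ suc))

sum-zero : ∀ {n} {h : Fin n → ℕ} → (∀ a → h a ≡ 0) → sum h ≡ 0
sum-zero {n} h≡0 = trans (sum-cong-≗ h≡0) (sum-replicate-zero n)

∑-δ : ∀ {n} (i : Fin n) → ∑[ a < n ] 𝟙 (does (a ≟ i)) ≡ 1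
∑-δ {suc n} zero    = cong suc (sum-replicate-zero n)
∑-δ {suc n} (suc i) = ∑-δ i

∑-δ-scaled : ∀ {n} (i : Fin n) x → ∑[ a < n ] (𝟙 (does (a ≟ i)) * x) ≡ x
∑-δ-scaled i x =
  trans (sym (*-distribʳ-sum x (λ a → 𝟙 (does (a ≟ i))))) (trans (cong (_* x) (∑-δ i)) (*-identityˡ x))

∑-𝟙-unique : ∀ {n} (P : Fin n → Bool) i → T (P i) → (∀ a → T (P a) → a ≡ i) →
             ∑[ a < n ] 𝟙 (P a) ≡ 1
∑-𝟙-unique P i Pi unique = trans (sum-cong-≗ δ-form) (∑-δ i)
  where
  δ-form : ∀ a → 𝟙 (P a) ≡ 𝟙 (does (a ≟ i))
  δ-form a with a ≟ i
  ... | yes refl = cong 𝟙 (Equivalence.to T-≡ Pi)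
  ... | no  a≢i with P a in Pa
  ...   | true  = ⊥-elim (a≢i (unique a (Equivalence.from T-≡ Pa)))
  ...   | false = refl

module _ {n} {i j : Fin n} (i≢j : i ≢ j) where

  private
    outside : Fin n → ℕ
    outside a = 𝟙 (not (does (a ≟ i)) ∧ not (does (a ≟ j)))

    decompose : ∀ (h : Fin n → ℕ) a →
                h a ≡ outside a * h a + 𝟙 (does (a ≟ i)) * h i + 𝟙 (does (a ≟ j)) * h j
    decompose h a with a ≟ i | a ≟ j
    ... | yes refl | yes refl = ⊥-elim (i≢j refl)
    ... | yes refl | no  _    = sym (trans (+-identityʳ _) (+-identityʳ _))
    ... | no  _    | yes refl = sym (+-identityʳ _)
    ... | no  _    | no  _    = sym (trans (+-identityʳ _) (trans (+-identityʳ _) (+-identityʳ _)))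

    outside-mono : ∀ a {x y} → (a ≢ i → a ≢ j → x ≤ y) → outside a * x ≤ outside a * y
    outside-mono a x≤y with a ≟ i | a ≟ j
    ... | yes _    | _        = z≤n
    ... | no  _    | yes _    = z≤n
    ... | no  a≢i  | no  a≢j  = +-monoˡ-≤ 0 (x≤y a≢i a≢j)

    ∑-split-pair : ∀ (h : Fin n → ℕ) → sum h ≡ ∑[ a < n ] (outside a * h a) + (h i + h j)
    ∑-split-pair h = begin
      sum h
        ≡⟨ sum-cong-≗ (decompose h) ⟩
      ∑[ a < n ] (outside a * h a + 𝟙 (does (a ≟ i)) * h i + 𝟙 (does (a ≟ j)) * h j)
        ≡⟨ ∑-distrib-+ (λ a → outside a * h a + 𝟙 (does (a ≟ i)) * h i)
                       (λ a → 𝟙 (does (a ≟ j)) * h j) ⟩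
      ∑[ a < n ] (outside a * h a + 𝟙 (does (a ≟ i)) * h i) + ∑[ a < n ] (𝟙 (does (a ≟ j)) * h j)
        ≡⟨ cong₂ _+_ (∑-distrib-+ (λ a → outside a * h a) (λ a → 𝟙 (does (a ≟ i)) * h i))
                     (∑-δ-scaled j (h j)) ⟩
      ∑[ a < n ] (outside a * h a) + ∑[ a < n ] (𝟙 (does (a ≟ i)) * h i) + h j
        ≡⟨ cong (λ x → ∑[ a < n ] (outside a * h a) + x + h j) (∑-δ-scaled i (h i)) ⟩
      ∑[ a < n ] (outside a * h a) + h i + h j
        ≡⟨ +-assoc _ (h i) (h j) ⟩
      ∑[ a < n ] (outside a * h a) + (h i + h j) ∎
      where open ≡-Reasoning

  sum-mono-off-pair : ∀ (h k : Fin n → ℕ) → (∀ a → a ≢ i → a ≢ j → h a ≤ k a) →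
                      h i + h j ≤ k i + k j → sum h ≤ sum k
  sum-mono-off-pair h k off pair = begin
    sum h                                     ≡⟨ ∑-split-pair h ⟩
    ∑[ a < n ] (outside a * h a) + (h i + h j) ≤⟨ +-mono-≤ (sum-mono-≤ (λ a → outside-mono a (off a))) pair ⟩
    ∑[ a < n ] (outside a * k a) + (k i + k j) ≡⟨ ∑-split-pair k ⟨
    sum k                                     ∎
    where open ≤-Reasoning

  ∑∑-mono-off-pair : ∀ (X Y : Fin n → Fin n → ℕ) →
    (∀ a b → a ≢ i → a ≢ j → b ≢ i → b ≢ j → X a b ≤ Y a b) →
    (∀ a → a ≢ i → a ≢ j → X a i + X a j ≤ Y a i + Y a j) →
    (∀ b → b ≢ i → b ≢ j → X i b + X j b ≤ Y i b + Y j b) →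
    (X i i + X j i) + (X i j + X j j) ≤ (Y i i + Y j i) + (Y i j + Y j j) →
    ∑[ a < n ] ∑[ b < n ] X a b ≤ ∑[ a < n ] ∑[ b < n ] Y a b
  ∑∑-mono-off-pair X Y off rows cols corner =
    sum-mono-off-pair (sum ∘ X) (sum ∘ Y)
      (λ a a≢i a≢j → sum-mono-off-pair (X a) (Y a) (λ b → off a b a≢i a≢j) (rows a a≢i a≢j))
      (begin
        sum (X i) + sum (X j)          ≡⟨ ∑-distrib-+ (X i) (X j) ⟨
        ∑[ b < n ] (X i b + X j b)     ≤⟨ sum-mono-off-pair _ _ cols corner ⟩
        ∑[ b < n ] (Y i b + Y j b)     ≡⟨ ∑-distrib-+ (Y i) (Y j) ⟩
        sum (Y i) + sum (Y j)          ∎)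
    where open ≤-Reasoning

count : ∀ {A : Set} → (A → Bool) → List A → ℕ
count p xs = length (filterᵇ p xs)

count-tabulate : ∀ {A : Set} {n} (p : A → Bool) (f : Fin n → A) →
                 count p (tabulate f) ≡ ∑[ a < n ] 𝟙 (p (f a))
count-tabulate {n = zero}  p f = refl
count-tabulate {n = suc n} p f with p (f zero)
... | true  = cong suc (count-tabulate p (f ∘ suc))
... | false = count-tabulate p (f ∘ suc)

count-filterᵇ : ∀ {A : Set} (p q : A → Bool) xs → count q (filterᵇ p xs) ≡ count (λ x → p x ∧ q x) xs
count-filterᵇ p q []       = refl
count-filterᵇ p q (x ∷ xs) with p x
... | false = count-filterᵇ p q xs
... | true with q x
...   | true  = cong suc (count-filterᵇ p q xs)
...   | false = count-filterᵇ p q xs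

count-pair : ∀ {A : Set} (p : A → Bool) x y → count p (x ∷ y ∷ []) ≡ 𝟙 (p x) + 𝟙 (p y)
count-pair p x y with p x
... | true  with p y
...   | true  = refl
...   | false = refl
count-pair p x y | false with p y
...   | true  = refl
...   | false = refl

length-concatMap-tabulate : ∀ {A B : Set} {n} (g : A → List B) (f : Fin n → A) →
                            length (concatMap g (tabulate f)) ≡ ∑[ a < n ] length (g (f a))
length-concatMap-tabulate {n = zero}  g f = refl
length-concatMap-tabulate {n = suc n} g f =
  trans (length-++ (g (f zero))) (cong (length (g (f zero)) +_) (length-concatMap-tabulate g (f ∘ suc)))

inversions-∑∑ : ∀ {n} (f : Fin n → Fin n) → inversions f ≡ ∑[ a < n ] ∑[ b < n ] 𝟙 (isInv f a b)
inversions-∑∑ {n} f =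
  trans (length-concatMap-tabulate (λ a → filterᵇ (isInv f a) (allFin n)) (λ a → a))
        (sum-cong-≗ (λ a → count-tabulate (isInv f a) (λ b → b)))

record ValuesSwapped {n} (i j : Fin n) (f g : Fin n → Fin n) : Set where
  field
    at-i      : g i ≡ f j
    at-j      : g j ≡ f i
    elsewhere : ∀ a → a ≢ i → a ≢ j → g a ≡ f a

ValuesSwapped-sym : ∀ {n} {i j : Fin n} {f g} → ValuesSwapped i j f g → ValuesSwapped j i f g
ValuesSwapped-sym sw = record { at-i = at-j ; at-j = at-i ; elsewhere = λ a a≢j a≢i → elsewhere a a≢i a≢j }
  where open ValuesSwapped sw

swap-ValuesSwapped : ∀ {n} {i j : Fin n} (f : Fin n → Fin n) → i ≢ j → ValuesSwapped i j f (f ∘f swap i j)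
swap-ValuesSwapped {i = i} {j} f i≢j = record
  { at-i      = cong f swap-i
  ; at-j      = cong f swap-j
  ; elsewhere = λ a a≢i a≢j → cong f (swap-other a a≢i a≢j)
  }
  where
  swap-i : swap i j i ≡ j
  swap-i with i ≟ i
  ... | yes _   = refl
  ... | no  i≢i = ⊥-elim (i≢i refl)

  swap-j : swap i j j ≡ i
  swap-j with j ≟ i
  ... | yes j≡i = ⊥-elim (i≢j (sym j≡i))
  ... | no  _ with j ≟ j
  ...   | yes _   = refl
  ...   | no  j≢j = ⊥-elim (j≢j refl)

  swap-other : ∀ a → a ≢ i → a ≢ j → swap i j a ≡ a
  swap-other a a≢i a≢j with a ≟ i
  ... | yes a≡i = ⊥-elim (a≢i a≡i)
  ... | no  _ with a ≟ j
  ...   | yes a≡j = ⊥-elim (a≢j a≡j)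
  ...   | no  _   = refl

no-inversion : ∀ {n} (f : Fin n → Fin n) {a b} →
               (toℕ a < toℕ b → toℕ (f b) < toℕ (f a) → ⊥) → 𝟙 (isInv f a b) ≡ 0
no-inversion f {a} {b} ¬inv with isInv f a b in inv
... | false = refl
... | true with Equivalence.to T-∧ (Equivalence.from T-≡ inv)
...   | a<b , fb<fa = ⊥-elim (¬inv (<ᵇ⇒< _ _ a<b) (<ᵇ⇒< _ _ fb<fa))

inversions-swap-descent : ∀ {n} {i j : Fin n} {f g} → ValuesSwapped i j f g →
  toℕ i < toℕ j → toℕ (f j) ≤ toℕ (f i) → inversions g ≤ inversions f
inversions-swap-descent {n} {i} {j} {f} {g} sw i<j fj≤fi =
  subst₂ _≤_ (sym (inversions-∑∑ g)) (sym (inversions-∑∑ f))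
    (∑∑-mono-off-pair (<⇒≢ i<j) _ _ off rows cols (≤-trans (≤-reflexive corner) z≤n))
  where
  open ValuesSwapped sw

  off : ∀ a b → a ≢ i → a ≢ j → b ≢ i → b ≢ j → 𝟙 (isInv g a b) ≤ 𝟙 (isInv f a b)
  off a b a≢i a≢j b≢i b≢j rewrite elsewhere a a≢i a≢j | elsewhere b b≢i b≢j = ≤-refl

  rows : ∀ a → a ≢ i → a ≢ j →
         𝟙 (isInv g a i) + 𝟙 (isInv g a j) ≤ 𝟙 (isInv f a i) + 𝟙 (isInv f a j)
  rows a a≢i a≢j rewrite elsewhere a a≢i a≢j | at-i | at-j =
    𝟙-rearrangement (λ a<i → <ᵇ-≤-trans {toℕ a} a<i (<⇒≤ i<j)) (≤-<ᵇ-trans {z = toℕ (f a)} fj≤fi)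

  cols : ∀ b → b ≢ i → b ≢ j →
         𝟙 (isInv g i b) + 𝟙 (isInv g j b) ≤ 𝟙 (isInv f i b) + 𝟙 (isInv f j b)
  cols b b≢i b≢j rewrite elsewhere b b≢i b≢j | at-i | at-j =
    𝟙-rearrangement′ (≤-<ᵇ-trans {z = toℕ b} (<⇒≤ i<j)) (λ fb<fj → <ᵇ-≤-trans fb<fj fj≤fi)

  corner : (𝟙 (isInv g i i) + 𝟙 (isInv g j i)) + (𝟙 (isInv g i j) + 𝟙 (isInv g j j)) ≡ 0
  corner = cong₂ _+_
    (cong₂ _+_ (no-inversion g {i} {i} (λ i<i _ → <-irrefl refl i<i))
               (no-inversion g {j} {i} (λ j<i _ → <-asym i<j j<i)))
    (cong₂ _+_ (no-inversion g {i} {j}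
                 (λ _ gj<gi → <⇒≱ (subst₂ _<_ (cong toℕ at-j) (cong toℕ at-i) gj<gi) fj≤fi))
               (no-inversion g {j} {j} (λ j<j _ → <-irrefl refl j<j)))

inBox : ∀ {n} → (Fin n → Fin n) → ℕ → ℕ → ℕ → ℕ → Fin n → Bool
inBox f l₁ r₁ l₂ r₂ a = inRange l₁ r₁ (toℕ a) ∧ inRange l₂ r₂ (toℕ (f a))

box : ∀ {n} → (Fin n → Fin n) → ℕ → ℕ → ℕ → ℕ → ℕ
box {n} f l₁ r₁ l₂ r₂ = ∑[ a < n ] 𝟙 (inBox f l₁ r₁ l₂ r₂ a)

rank : ∀ {n} → (Fin n → Fin n) → ℕ → ℕ → ℕ
rank f p q = box f 0 p 0 q

box-cong : ∀ {n} {f g : Fin n → Fin n} → (∀ x → f x ≡ g x) →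
           ∀ l₁ r₁ l₂ r₂ → box f l₁ r₁ l₂ r₂ ≡ box g l₁ r₁ l₂ r₂
box-cong f≗g l₁ r₁ l₂ r₂ =
  sum-cong-≗ (λ a → cong (λ y → 𝟙 (inRange l₁ r₁ (toℕ a) ∧ inRange l₂ r₂ (toℕ y))) (f≗g a))

rank-swap-ascent : ∀ {n} {i j : Fin n} {f g} → ValuesSwapped i j f g →
  toℕ i < toℕ j → toℕ (f i) ≤ toℕ (f j) → ∀ p q → rank g p q ≤ rank f p q
rank-swap-ascent {n} {i} {j} {f} {g} sw i<j fi≤fj p q =
  sum-mono-off-pair (<⇒≢ i<j) (λ a → 𝟙 ((toℕ a <ᵇ p) ∧ (toℕ (g a) <ᵇ q)))
                              (λ a → 𝟙 ((toℕ a <ᵇ p) ∧ (toℕ (f a) <ᵇ q))) off pair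
  where
  open ValuesSwapped sw

  off : ∀ a → a ≢ i → a ≢ j →
        𝟙 ((toℕ a <ᵇ p) ∧ (toℕ (g a) <ᵇ q)) ≤ 𝟙 ((toℕ a <ᵇ p) ∧ (toℕ (f a) <ᵇ q))
  off a a≢i a≢j rewrite elsewhere a a≢i a≢j = ≤-refl

  pair : 𝟙 ((toℕ i <ᵇ p) ∧ (toℕ (g i) <ᵇ q)) + 𝟙 ((toℕ j <ᵇ p) ∧ (toℕ (g j) <ᵇ q)) ≤
         𝟙 ((toℕ i <ᵇ p) ∧ (toℕ (f i) <ᵇ q)) + 𝟙 ((toℕ j <ᵇ p) ∧ (toℕ (f j) <ᵇ q))
  pair rewrite at-i | at-j =
    𝟙-rearrangement′ (≤-<ᵇ-trans {z = p} (<⇒≤ i<j)) (≤-<ᵇ-trans {z = q} fi≤fj)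

ascent-of-longer-swap : ∀ {n} {i j : Fin n} {f g} → ValuesSwapped i j f g →
  toℕ i < toℕ j → inversions f < inversions g → toℕ (f i) ≤ toℕ (f j)
ascent-of-longer-swap sw i<j longer =
  ≮⇒≥ (λ fj<fi → <⇒≱ longer (inversions-swap-descent sw i<j (<⇒≤ fj<fi)))

rank-longer-swap : ∀ {n} {i j : Fin n} {f g} → i ≢ j → ValuesSwapped i j f g →
  inversions f < inversions g → ∀ p q → rank g p q ≤ rank f p q
rank-longer-swap {i = i} {j} i≢j sw longer with <-cmp (toℕ i) (toℕ j)
... | tri< i<j _ _ = rank-swap-ascent sw i<j (ascent-of-longer-swap sw i<j longer)
... | tri≈ _ i≡j _ = ⊥-elim (i≢j (toℕ-injective i≡j))
... | tri> _ _ j<i =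
  rank-swap-ascent (ValuesSwapped-sym sw) j<i (ascent-of-longer-swap (ValuesSwapped-sym sw) j<i longer)

rank-antitone : ∀ {n} {f g : Fin n → Fin n} → BruhatChain f g → ∀ p q → rank g p q ≤ rank f p q
rank-antitone (done f≗g) p q = ≤-reflexive (box-cong (λ x → sym (f≗g x)) 0 p 0 q)
rank-antitone {f = f} (step i j i≢j longer chain) p q =
  ≤-trans (rank-antitone chain p q) (rank-longer-swap i≢j (swap-ValuesSwapped f i≢j) longer p q)

𝟙-∧-splitʳ : ∀ a {b b₁ b₂} → 𝟙 b ≡ 𝟙 b₁ + 𝟙 b₂ → 𝟙 (a ∧ b) ≡ 𝟙 (a ∧ b₁) + 𝟙 (a ∧ b₂)
𝟙-∧-splitʳ true  split = split
𝟙-∧-splitʳ false _     = refl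

𝟙-∧-splitˡ : ∀ {a a₁ a₂} b → 𝟙 a ≡ 𝟙 a₁ + 𝟙 a₂ → 𝟙 (a ∧ b) ≡ 𝟙 (a₁ ∧ b) + 𝟙 (a₂ ∧ b)
𝟙-∧-splitˡ {a} {a₁} {a₂} b split = begin
  𝟙 (a ∧ b)                   ≡⟨ cong 𝟙 (∧-comm a b) ⟩
  𝟙 (b ∧ a)                   ≡⟨ 𝟙-∧-splitʳ b split ⟩
  𝟙 (b ∧ a₁) + 𝟙 (b ∧ a₂)     ≡⟨ cong₂ _+_ (cong 𝟙 (∧-comm b a₁)) (cong 𝟙 (∧-comm b a₂)) ⟩
  𝟙 (a₁ ∧ b) + 𝟙 (a₂ ∧ b)     ∎
  where open ≡-Reasoning

box-split-rows : ∀ {n} (f : Fin n → Fin n) {l m r} → l ≤ m → m ≤ r → ∀ l₂ r₂ →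
                 box f l r l₂ r₂ ≡ box f l m l₂ r₂ + box f m r l₂ r₂
box-split-rows f {l} {m} {r} l≤m m≤r l₂ r₂ =
  trans (sum-cong-≗ (λ a → 𝟙-∧-splitˡ {a₁ = inRange l m (toℕ a)} {inRange m r (toℕ a)}
                                       (inRange l₂ r₂ (toℕ (f a))) (inRange-split l≤m m≤r (toℕ a))))
        (∑-distrib-+ (λ a → 𝟙 (inBox f l m l₂ r₂ a)) (λ a → 𝟙 (inBox f m r l₂ r₂ a)))

box-split-cols : ∀ {n} (f : Fin n → Fin n) {l m r} → l ≤ m → m ≤ r → ∀ l₁ r₁ →
                 box f l₁ r₁ l r ≡ box f l₁ r₁ l m + box f l₁ r₁ m r
box-split-cols f {l} {m} {r} l≤m m≤r l₁ r₁ =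
  trans (sum-cong-≗ (λ a → 𝟙-∧-splitʳ (inRange l₁ r₁ (toℕ a)) {b₁ = inRange l m (toℕ (f a))} {inRange m r (toℕ (f a))}
                                       (inRange-split l≤m m≤r (toℕ (f a)))))
        (∑-distrib-+ (λ a → 𝟙 (inBox f l₁ r₁ l m a)) (λ a → 𝟙 (inBox f l₁ r₁ m r a)))

module _ {m} (π : Permutation′ (2 ^ m)) (well-distributed : DWD m π) where

  box-cell : ∀ {k₁ k₂} u v → k₁ + k₂ ≡ m → suc u * 2 ^ k₁ ≤ 2 ^ m → suc v * 2 ^ k₂ ≤ 2 ^ m →
             box (π ⟨$⟩ʳ_) (u * 2 ^ k₁) (suc u * 2 ^ k₁) (v * 2 ^ k₂) (suc v * 2 ^ k₂) ≡ 1
  box-cell {k₁} {k₂} u v levels u-fits v-fits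
    with well-distributed (interval k₁ u (subst (k₁ ≤_) levels (m≤m+n k₁ k₂)) u-fits)
                          (interval k₂ v (subst (k₂ ≤_) levels (m≤n+m k₂ k₁)) v-fits) levels
  ... | i , (i∈S , πi∈T) , unique =
    ∑-𝟙-unique _ i (Equivalence.from T-∧ (inRange⁺ i∈S , inRange⁺ πi∈T))
      (λ a a∈S×T → let a∈S , πa∈T = Equivalence.to T-∧ a∈S×T
                   in unique a (inRange⁻ a∈S , inRange⁻ πa∈T))

  box-row : ∀ {k₁ k₂} u w → k₁ + k₂ ≡ m → suc u * 2 ^ k₁ ≤ 2 ^ m → w * 2 ^ k₂ ≤ 2 ^ m →
            box (π ⟨$⟩ʳ_) (u * 2 ^ k₁) (suc u * 2 ^ k₁) 0 (w * 2 ^ k₂) ≡ w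
  box-row {k₁} u zero _ _ _ =
    sum-zero {2 ^ m} (λ a → cong 𝟙 (∧-zeroʳ (inRange (u * 2 ^ k₁) (suc u * 2 ^ k₁) (toℕ a))))
  box-row {k₁} {k₂} u (suc w) levels u-fits w-fits = begin
    box (π ⟨$⟩ʳ_) U U′ 0 (suc w * 2 ^ k₂)
      ≡⟨ box-split-cols (π ⟨$⟩ʳ_) z≤n (m≤n+m (w * 2 ^ k₂) (2 ^ k₂)) U U′ ⟩
    box (π ⟨$⟩ʳ_) U U′ 0 (w * 2 ^ k₂) + box (π ⟨$⟩ʳ_) U U′ (w * 2 ^ k₂) (suc w * 2 ^ k₂)
      ≡⟨ cong₂ _+_ (box-row {k₁} {k₂} u w levels u-fits (≤-trans (m≤n+m _ _) w-fits))
                   (box-cell {k₁} {k₂} u w levels u-fits w-fits) ⟩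
    w + 1
      ≡⟨ +-comm w 1 ⟩
    suc w ∎
    where
    open ≡-Reasoning
    U U′ : ℕ
    U  = u * 2 ^ k₁
    U′ = suc u * 2 ^ k₁

  box-prefix : ∀ {k₁ k₂} h w → k₁ + k₂ ≡ m → h * 2 ^ k₁ ≤ 2 ^ m → w * 2 ^ k₂ ≤ 2 ^ m →
               box (π ⟨$⟩ʳ_) 0 (h * 2 ^ k₁) 0 (w * 2 ^ k₂) ≡ h * w
  box-prefix zero w _ _ _ = sum-replicate-zero (2 ^ m)
  box-prefix {k₁} {k₂} (suc h) w levels h-fits w-fits = begin
    box (π ⟨$⟩ʳ_) 0 (suc h * 2 ^ k₁) 0 E
      ≡⟨ box-split-rows (π ⟨$⟩ʳ_) z≤n (m≤n+m (h * 2 ^ k₁) (2 ^ k₁)) 0 E ⟩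
    box (π ⟨$⟩ʳ_) 0 (h * 2 ^ k₁) 0 E + box (π ⟨$⟩ʳ_) (h * 2 ^ k₁) (suc h * 2 ^ k₁) 0 E
      ≡⟨ cong₂ _+_ (box-prefix {k₁} {k₂} h w levels (≤-trans (m≤n+m _ _) h-fits) w-fits)
                   (box-row {k₁} {k₂} h w levels h-fits w-fits) ⟩
    h * w + w
      ≡⟨ +-comm (h * w) w ⟩
    suc h * w ∎
    where
    open ≡-Reasoning
    E : ℕ
    E = w * 2 ^ k₂

pointsIn : ∀ {n} → (Fin n → Fin n) → ℕ → ℕ → ℕ → ℕ → List (Fin n)
pointsIn {n} f l₁ r₁ l₂ r₂ = filterᵇ (inBox f l₁ r₁ l₂ r₂) (allFin n)

pointsIn-sorted : ∀ {n} (f : Fin n → Fin n) l₁ r₁ l₂ r₂ → AllPairs Fin._<_ (pointsIn f l₁ r₁ l₂ r₂)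
pointsIn-sorted f l₁ r₁ l₂ r₂ =
  AllPairs.filter⁺ (T? ∘ inBox f l₁ r₁ l₂ r₂) (AllPairs.tabulate⁺-< (λ i<j → i<j))

length-pointsIn : ∀ {n} (f : Fin n → Fin n) l₁ r₁ l₂ r₂ →
                  length (pointsIn f l₁ r₁ l₂ r₂) ≡ box f l₁ r₁ l₂ r₂
length-pointsIn f l₁ r₁ l₂ r₂ = count-tabulate (inBox f l₁ r₁ l₂ r₂) (λ a → a)

count-pointsIn : ∀ {n} (f : Fin n → Fin n) l₁ r₁ l₂ r₂ (q : Fin n → Bool) →
  count q (pointsIn f l₁ r₁ l₂ r₂) ≡ ∑[ a < n ] 𝟙 (inBox f l₁ r₁ l₂ r₂ a ∧ q a)
count-pointsIn {n} f l₁ r₁ l₂ r₂ q =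
  trans (count-filterᵇ (inBox f l₁ r₁ l₂ r₂) q (allFin n))
        (count-tabulate (λ a → inBox f l₁ r₁ l₂ r₂ a ∧ q a) (λ a → a))

ascents : S₂ → ℕ
ascents e = 1
ascents s = 0

ascents-if : ∀ b → ascents (if b then e else s) ≡ 𝟙 b
ascents-if true  = refl
ascents-if false = refl

≤₂-from-ascents : ∀ {x y} → ascents y ≤ ascents x → x ≤₂ y
≤₂-from-ascents {e} {e} _ = e≤e
≤₂-from-ascents {e} {s} _ = e≤s
≤₂-from-ascents {s} {s} _ = s≤s

ascent-of-straddling-pair : ∀ {a b fa fb u v} → a < b →
  𝟙 (a <ᵇ u) + 𝟙 (b <ᵇ u) ≡ 1 → 𝟙 (fa <ᵇ v) + 𝟙 (fb <ᵇ v) ≡ 1 →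
  𝟙 (fa <ᵇ fb) ≡ 𝟙 ((a <ᵇ u) ∧ (fa <ᵇ v)) + 𝟙 ((b <ᵇ u) ∧ (fb <ᵇ v))
ascent-of-straddling-pair {a} {b} {fa} {fb} {u} {v} a<b one-below-u one-below-v
  with a <ᵇ u | <ᵇ-reflects-< a u | b <ᵇ u | <ᵇ-reflects-< b u
... | true  | _        | false | _       = trans (cong 𝟙 (straddle {fa} {fb} {v} one-below-v)) (sym (+-identityʳ _))
... | false | ofⁿ a≮u  | true  | ofʸ b<u = ⊥-elim (a≮u (<-trans a<b b<u))
... | true  | _        | true  | _       = ⊥-elim (1+n≢0 (suc-injective one-below-u))
... | false | _        | false | _       = ⊥-elim (0≢1+n one-below-u)

ascents-φ-list : ∀ {m} (π : Permutation′ (2 ^ m)) {u v} xs → AllPairs Fin._<_ xs → length xs ≡ 2 →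
  count (λ a → toℕ a <ᵇ u) xs ≡ 1 → count (λ a → toℕ (π ⟨$⟩ʳ a) <ᵇ v) xs ≡ 1 →
  ascents (φ-list {m} π xs) ≡ count (λ a → (toℕ a <ᵇ u) ∧ (toℕ (π ⟨$⟩ʳ a) <ᵇ v)) xs
ascents-φ-list {m} π {u} {v} (x ∷ y ∷ []) ((x<y ∷ []) ∷ _) refl one-below-u one-below-v = begin
  ascents (φ-list {m} π (x ∷ y ∷ []))
    ≡⟨ ascents-if (toℕ (π ⟨$⟩ʳ x) <ᵇ toℕ (π ⟨$⟩ʳ y)) ⟩
  𝟙 (toℕ (π ⟨$⟩ʳ x) <ᵇ toℕ (π ⟨$⟩ʳ y))
    ≡⟨ ascent-of-straddling-pair {toℕ x} {toℕ y} {toℕ (π ⟨$⟩ʳ x)} {toℕ (π ⟨$⟩ʳ y)} {u} {v} x<y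
         (trans (sym (count-pair below-u x y)) one-below-u) (trans (sym (count-pair below-v x y)) one-below-v) ⟩
  𝟙 (below-u x ∧ below-v x) + 𝟙 (below-u y ∧ below-v y)
    ≡⟨ count-pair (λ a → below-u a ∧ below-v a) x y ⟨
  count (λ a → below-u a ∧ below-v a) (x ∷ y ∷ []) ∎
  where
  open ≡-Reasoning
  below-u below-v : Fin _ → Bool
  below-u a = toℕ a <ᵇ u
  below-v a = toℕ (π ⟨$⟩ʳ a) <ᵇ v

u*2^[1+k]≡u*2*2^k : ∀ u k → u * 2 ^ suc k ≡ u * 2 * 2 ^ k
u*2^[1+k]≡u*2*2^k u k = sym (*-assoc u 2 (2 ^ k))

module Centre {m} (π : Permutation′ (2 ^ m)) (well-distributed : DWD m π) {K₁ K₂ c d : ℕ}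
  (levels : K₁ + suc K₂ ≡ m) (S-fits : suc c * 2 ^ suc K₁ ≤ 2 ^ m) (T-fits : suc d * 2 ^ suc K₂ ≤ 2 ^ m) where

  -- S = [s₀, s₂) with halves [s₀, s₁) and [s₁, s₂); likewise T = [t₀, t₂).
  private
    f : Fin (2 ^ m) → Fin (2 ^ m)
    f = π ⟨$⟩ʳ_

    s₀ s₁ s₂ t₀ t₁ t₂ : ℕ
    s₀ = c * 2 ^ suc K₁
    s₁ = suc (c * 2) * 2 ^ K₁
    s₂ = suc c * 2 ^ suc K₁
    t₀ = d * 2 ^ suc K₂
    t₁ = suc (d * 2) * 2 ^ K₂
    t₂ = suc d * 2 ^ suc K₂

    levels′ : suc K₁ + K₂ ≡ m
    levels′ = trans (sym (+-suc K₁ K₂)) levels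

    s₀≤s₁ : s₀ ≤ s₁
    s₀≤s₁ = subst (_≤ s₁) (sym (u*2^[1+k]≡u*2*2^k c K₁)) (m≤n+m _ (2 ^ K₁))
    s₁≤s₂ : s₁ ≤ s₂
    s₁≤s₂ = subst (s₁ ≤_) (sym (u*2^[1+k]≡u*2*2^k (suc c) K₁)) (m≤n+m s₁ (2 ^ K₁))
    t₀≤t₁ : t₀ ≤ t₁
    t₀≤t₁ = subst (_≤ t₁) (sym (u*2^[1+k]≡u*2*2^k d K₂)) (m≤n+m _ (2 ^ K₂))
    t₁≤t₂ : t₁ ≤ t₂
    t₁≤t₂ = subst (t₁ ≤_) (sym (u*2^[1+k]≡u*2*2^k (suc d) K₂)) (m≤n+m t₁ (2 ^ K₂))

    S₀×T : box f s₀ s₁ t₀ t₂ ≡ 1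
    S₀×T = trans (cong (λ l → box f l s₁ t₀ t₂) (u*2^[1+k]≡u*2*2^k c K₁))
                 (box-cell π well-distributed {K₁} {suc K₂} (c * 2) d levels (≤-trans s₁≤s₂ S-fits) T-fits)

    S₁×T : box f s₁ s₂ t₀ t₂ ≡ 1
    S₁×T = trans (cong (λ r → box f s₁ r t₀ t₂) (u*2^[1+k]≡u*2*2^k (suc c) K₁))
                 (box-cell π well-distributed {K₁} {suc K₂} (suc (c * 2)) d levels
                           (subst (_≤ 2 ^ m) (u*2^[1+k]≡u*2*2^k (suc c) K₁) S-fits) T-fits)

    S×T₀ : box f s₀ s₂ t₀ t₁ ≡ 1
    S×T₀ = trans (cong (λ l → box f s₀ s₂ l t₁) (u*2^[1+k]≡u*2*2^k d K₂))
                 (box-cell π well-distributed {suc K₁} {K₂} c (d * 2) levels′ S-fits (≤-trans t₁≤t₂ T-fits))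

    S₀×below-T : box f s₀ s₁ 0 t₀ ≡ d
    S₀×below-T = trans (cong (λ l → box f l s₁ 0 t₀) (u*2^[1+k]≡u*2*2^k c K₁))
                       (box-row π well-distributed {K₁} {suc K₂} (c * 2) d levels (≤-trans s₁≤s₂ S-fits)
                                (≤-trans (m≤n+m t₀ _) T-fits))

    below-S : box f 0 s₀ 0 t₁ ≡ c * suc (d * 2)
    below-S = box-prefix π well-distributed {suc K₁} {K₂} c (suc (d * 2)) levels′
                (≤-trans (m≤n+m s₀ _) S-fits) (≤-trans t₁≤t₂ T-fits)

    rank-at-centre-quadrant : rank f s₁ t₁ ≡ c * suc (d * 2) + d + box f s₀ s₁ t₀ t₁
    rank-at-centre-quadrant = begin
      box f 0 s₁ 0 t₁                           ≡⟨ box-split-rows f z≤n s₀≤s₁ 0 t₁ ⟩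
      box f 0 s₀ 0 t₁ + box f s₀ s₁ 0 t₁        ≡⟨ cong₂ _+_ below-S (box-split-cols f z≤n t₀≤t₁ s₀ s₁) ⟩
      c * suc (d * 2) + (box f s₀ s₁ 0 t₀ + Q)  ≡⟨ cong (λ x → c * suc (d * 2) + (x + Q)) S₀×below-T ⟩
      c * suc (d * 2) + (d + Q)                 ≡⟨ +-assoc (c * suc (d * 2)) d Q ⟨
      c * suc (d * 2) + d + Q                   ∎
      where
      open ≡-Reasoning
      Q : ℕ
      Q = box f s₀ s₁ t₀ t₁

    L : List (Fin (2 ^ m))
    L = pointsIn f s₀ s₂ t₀ t₂

    restricted-count : ∀ q l₁ r₁ l₂ r₂ → (∀ a → inBox f s₀ s₂ t₀ t₂ a ∧ q a ≡ inBox f l₁ r₁ l₂ r₂ a) →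
                       count q L ≡ box f l₁ r₁ l₂ r₂
    restricted-count q _ _ _ _ same = trans (count-pointsIn f s₀ s₂ t₀ t₂ q) (sum-cong-≗ (cong 𝟙 ∘ same))

    φ-ascents-quadrant : ascents (φ-list {m} π L) ≡ box f s₀ s₁ t₀ t₁
    φ-ascents-quadrant =
      trans (ascents-φ-list π {s₁} {t₁} L (pointsIn-sorted f s₀ s₂ t₀ t₂) two one-below-s₁ one-below-t₁)
            quadrant
      where
      two : length L ≡ 2
      two = trans (length-pointsIn f s₀ s₂ t₀ t₂)
                  (trans (box-split-rows f s₀≤s₁ s₁≤s₂ t₀ t₂) (cong₂ _+_ S₀×T S₁×T))

      one-below-s₁ : count (λ a → toℕ a <ᵇ s₁) L ≡ 1
      one-below-s₁ = trans (restricted-count (λ a → toℕ a <ᵇ s₁) s₀ s₁ t₀ t₂ (λ a →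
          trans (xy∙z≈xz∙y (inRange s₀ s₂ (toℕ a)) (inRange t₀ t₂ (toℕ (f a))) (toℕ a <ᵇ s₁))
                (cong (_∧ inRange t₀ t₂ (toℕ (f a))) (inRange-∧-<ᵇ s₀ s₁≤s₂ (toℕ a)))))
        S₀×T

      one-below-t₁ : count (λ a → toℕ (f a) <ᵇ t₁) L ≡ 1
      one-below-t₁ = trans (restricted-count (λ a → toℕ (f a) <ᵇ t₁) s₀ s₂ t₀ t₁ (λ a →
          trans (∧-assoc (inRange s₀ s₂ (toℕ a)) (inRange t₀ t₂ (toℕ (f a))) (toℕ (f a) <ᵇ t₁))
                (cong (inRange s₀ s₂ (toℕ a) ∧_) (inRange-∧-<ᵇ t₀ t₁≤t₂ (toℕ (f a))))))
        S×T₀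

      quadrant : count (λ a → (toℕ a <ᵇ s₁) ∧ (toℕ (f a) <ᵇ t₁)) L ≡ box f s₀ s₁ t₀ t₁
      quadrant = restricted-count (λ a → (toℕ a <ᵇ s₁) ∧ (toℕ (f a) <ᵇ t₁)) s₀ s₁ t₀ t₁ (λ a →
        trans (interchange (inRange s₀ s₂ (toℕ a)) (inRange t₀ t₂ (toℕ (f a)))
                           (toℕ a <ᵇ s₁) (toℕ (f a) <ᵇ t₁))
              (cong₂ _∧_ (inRange-∧-<ᵇ s₀ s₁≤s₂ (toℕ a)) (inRange-∧-<ᵇ t₀ t₁≤t₂ (toℕ (f a)))))

  rank-at-centre : rank f s₁ t₁ ≡ c * suc (d * 2) + d + ascents (φ-list {m} π L)
  rank-at-centre = trans rank-at-centre-quadrant (cong (c * suc (d * 2) + d +_) (sym φ-ascents-quadrant))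

lemma2p16 : (m : ℕ) → 1 ≤ m → (π₁ π₂ : Permutation′ (2 ^ m)) →
    DWD m π₁ → DWD m π₂ → π₁ ≤B π₂ → φ {m} π₁ ≤φ φ {m} π₂
lemma2p16 m _ π₁ π₂ dwd₁ dwd₂ π₁≤π₂
  P@(cpair (interval (suc K₁) c _ S-fits) (interval (suc K₂) d _ T-fits) levels (s≤s z≤n) (s≤s z≤n)) =
  ≤₂-from-ascents (+-cancelˡ-≤ base _ _ (begin
    base + ascents (φ π₂ P)     ≡⟨ C₂.rank-at-centre ⟨
    rank (π₂ ⟨$⟩ʳ_) x₀ y₀       ≤⟨ rank-antitone π₁≤π₂ x₀ y₀ ⟩
    rank (π₁ ⟨$⟩ʳ_) x₀ y₀       ≡⟨ C₁.rank-at-centre ⟩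
    base + ascents (φ π₁ P)     ∎))
  where
  open ≤-Reasoning
  module C₁ = Centre π₁ dwd₁ {K₁} {K₂} {c} {d} (suc-injective levels) S-fits T-fits
  module C₂ = Centre π₂ dwd₂ {K₁} {K₂} {c} {d} (suc-injective levels) S-fits T-fits
  x₀ y₀ base : ℕ
  x₀   = suc (c * 2) * 2 ^ K₁
  y₀   = suc (d * 2) * 2 ^ K₂
  base = c * suc (d * 2) + d
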